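{- Let $G=(V,E)$ be a strongly connected directed graph and $P=(p_1,\dots,p_\ell)$ a cut path in $G$ of length $\ell-1\ge1$. Let $u\in S^+(P)$ and $v\in S^-(P)$. Then every $u$-$v$ walk in $G$ contains $P$ as a subwalk.
   Context: A walk is a sequence of nodes with consecutive pairs being arcs; a $u$-$v$ walk starts at $u$ and ends at $v$. A subwalk is a contiguous subsequence. A walk $P$ is a cut path if there exist nodes $u,v$ such that every $u$-$v$ walk in $G$ has $P$ as a subwalk. $R^+(P)$ is the set of nodes $x$ such that there is a $p_1$-$x$ walk in $G$ with arc $(p_{\ell-1},p_\ell)$ removed; $R^-(P)$ is the set of nodes $x$ such that there is an $x$-$p_\ell$ walk in $G$ with arc $(p_1,p_2)$ removed. $S^+(P):=R^+(P)\setminus R^-(P)$ and $S^-(P):=R^-(P)\setminus R^+(P)$. -}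

module Defs where

open import Level using (Level; _⊔_; suc)
open import Data.List using (List; []; _∷_; _++_)
open import Data.Product using (Σ; _×_; proj₁; proj₂; _,_; ∃; ∃-syntax)
open import Relation.Binary.PropositionalEquality using (_≡_)
open import Relation.Nullary using (¬_)

record Digraph (a b : Level) : Set (Level.suc (a ⊔ b)) where
  field
    V : Set a
    E : V → V → Set b

module _ {a b : Level} (G : Digraph a b) where
  open Digraph G

  removeArc : V → V → (V → V → Set (a ⊔ b))
  removeArc x y s t = E s t × ¬ (s ≡ x × t ≡ y)

-- Walks w.r.t. an arbitrary arc relation R, as nonempty node lists
-- (first node, remaining nodes) with consecutive pairs being arcs.
-- WalkR R u w v : the list u ∷ w is a u-v walk.
data WalkR {a c : Level} {V : Set a} (R : V → V → Set c) : V → List V → V → Set (a ⊔ c) where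
  stop : ∀ {u} → WalkR R u [] u
  step : ∀ {u x xs v} → R u x → WalkR R x xs v → WalkR R u (x ∷ xs) v

module _ {a b : Level} (G : Digraph a b) where
  open Digraph G

  IsWalk : V → List V → V → Set (a ⊔ b)
  IsWalk = WalkR E

  HasWalk : V → V → Set (a ⊔ b)
  HasWalk u v = ∃[ w ] IsWalk u w v

  StronglyConnected : Set (a ⊔ b)
  StronglyConnected = ∀ x y → HasWalk x y

  Subwalk : List V → List V → Set a
  Subwalk Q W = ∃[ xs ] ∃[ ys ] W ≡ xs ++ Q ++ ys

  AllWalksThrough : V → V → List V → Set (a ⊔ b)
  AllWalksThrough u v Q = ∀ w → IsWalk u w v → Subwalk Q (u ∷ w)

  IsCutPath : List V → Set (a ⊔ b)
  IsCutPath Q = (∃[ p ] ∃[ r ] ∃[ q ] (Q ≡ p ∷ r × IsWalk p r q))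
              × (∃[ u ] ∃[ v ] AllWalksThrough u v Q)

  -- For a path P = (p₁, p₂, …, p_{ℓ-1}, p_ℓ) with ℓ ≥ 2, written as
  -- p₁ ∷ p₂ ∷ rest, we need p_{ℓ-1} and p_ℓ.
  lastTwo : V → V → List V → V × V
  lastTwo x y [] = x , y
  lastTwo x y (z ∷ zs) = lastTwo y z zs

  R⁺ : V → V → List V → V → Set (a ⊔ b)
  R⁺ p₁ p₂ rest x =
    ∃[ w ] WalkR (removeArc G (proj₁ (lastTwo p₁ p₂ rest)) (proj₂ (lastTwo p₁ p₂ rest))) p₁ w x

  R⁻ : V → V → List V → V → Set (a ⊔ b)
  R⁻ p₁ p₂ rest x = ∃[ w ] WalkR (removeArc G p₁ p₂) x w (proj₂ (lastTwo p₁ p₂ rest))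

  S⁺ : V → V → List V → V → Set (a ⊔ b)
  S⁺ p₁ p₂ rest x = R⁺ p₁ p₂ rest x × ¬ R⁻ p₁ p₂ rest x

  S⁻ : V → V → List V → V → Set (a ⊔ b)
  S⁻ p₁ p₂ rest x = R⁻ p₁ p₂ rest x × ¬ R⁺ p₁ p₂ rest x

{-# OPTIONS --safe #-}
-- Let every x-y walk contain P. Concatenate a walk x → p₁, a walk p₁ → u
-- avoiding the last arc of P (u ∈ R⁺), the given u-v walk, a walk v → pₗ
-- avoiding the first arc of P (v ∈ R⁻) and a walk pₗ → y. A cut path repeats
-- no node (a repeat could be shortcut forever), so this occurrence of P does
-- not pass through p₁ or pₗ in its interior, nor through u (u ∉ R⁻) or v
-- (v ∉ R⁺), and it cannot lie inside the two arc-avoiding walks. Hence it lies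
-- in the u-v walk, or inside the first or last walk, where it yields a shorter
-- choice of that walk; induction on their total length concludes.
module Submission where

open import Defs
open import Level using (Level)
open import Data.List using (List; []; _∷_; _++_; _∷ʳ_; [_]; length)
open import Data.List.Properties using (++-assoc; ∷-injective; ∷-injectiveʳ; length-++-≤ʳ)
open import Data.List.Membership.Propositional using (_∈_; _∉_)
open import Data.List.Membership.Propositional.Properties using (∈-∃++; ∈-++⁺ʳ; ∈-++⁺ˡ)
open import Data.List.Relation.Unary.Any using (here; there)
open import Data.Nat using (_<_; _+_; s≤s; z≤n)
open import Data.Nat.Properties using (n<1+n; m<n⇒m<1+n; +-monoˡ-<; +-monoʳ-<)
open import Data.Nat.Induction using (<-wellFounded)
open import Induction.WellFounded using (Acc; acc)
open import Data.Product using (_×_; proj₁; proj₂; _,_; ∃-syntax; map₁)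
open import Data.Sum using (_⊎_; inj₁; inj₂)
open import Data.Empty using (⊥; ⊥-elim)
open import Relation.Nullary using (¬_)
open import Relation.Binary.PropositionalEquality using (_≡_; refl; sym; trans; cong; subst)

module _ {ℓ : Level} {A : Set ℓ} where

  HasRepeat : List A → Set ℓ
  HasRepeat L = ∃[ I ] ∃[ s ] ∃[ J ] L ≡ I ++ s ∷ J × s ∈ J

  Interior : A → List A → Set ℓ
  Interior t Q = ∃[ h ] ∃[ Q₁ ] ∃[ k ] ∃[ Q₂ ] Q ≡ h ∷ Q₁ ++ t ∷ k ∷ Q₂

  repeat-∷ : ∀ {h L} → HasRepeat L → HasRepeat (h ∷ L)
  repeat-∷ {h} (I , s , J , refl , s∈J) = h ∷ I , s , J , refl , s∈J

  repeat-++ : ∀ {s} L₁ {L₂} → s ∈ L₁ → s ∈ L₂ → HasRepeat (L₁ ++ L₂)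
  repeat-++ L₁ {L₂} s∈L₁ s∈L₂ with I , J , refl ← ∈-∃++ s∈L₁ =
    I , _ , J ++ L₂ , ++-assoc I (_ ∷ J) L₂ , ∈-++⁺ʳ J s∈L₂

  repeat-infix : ∀ xs {Q} ys → HasRepeat Q → HasRepeat (xs ++ Q ++ ys)
  repeat-infix xs ys (I , s , J , refl , s∈J) =
    xs ++ I , s , J ++ ys ,
    trans (cong (xs ++_) (++-assoc I (s ∷ J) ys)) (sym (++-assoc xs I (s ∷ J ++ ys))) ,
    ∈-++⁺ˡ s∈J

  prefix-split : ∀ I (t : A) B Q ys → I ++ t ∷ B ≡ Q ++ ys →
                 (∃[ m ] I ∷ʳ t ≡ Q ++ m) ⊎ (∃[ k ] ∃[ Q₂ ] Q ≡ I ++ t ∷ k ∷ Q₂)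
  prefix-split I t B [] ys eq = inj₁ (I ∷ʳ t , refl)
  prefix-split [] t B (q ∷ []) ys refl = inj₁ ([] , refl)
  prefix-split [] t B (q ∷ k ∷ Q₂) ys refl = inj₂ (k , Q₂ , refl)
  prefix-split (i ∷ I) t B (q ∷ Q) ys eq with refl , eq′ ← ∷-injective eq
    with prefix-split I t B Q ys eq′
  ... | inj₁ (m , e) = inj₁ (m , cong (i ∷_) e)
  ... | inj₂ (k , Q₂ , e) = inj₂ (k , Q₂ , cong (i ∷_) e)

  infix-split : ∀ I (t : A) B xs Q ys → I ++ t ∷ B ≡ xs ++ Q ++ ys →
                (∃[ m ] I ∷ʳ t ≡ xs ++ Q ++ m) ⊎ (∃[ m ] t ∷ B ≡ m ++ Q ++ ys) ⊎ Interior t Q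
  infix-split [] t B xs Q ys eq = inj₂ (inj₁ (xs , eq))
  infix-split (i ∷ I) t B [] Q ys eq = at-front (prefix-split (i ∷ I) t B Q ys eq)
    where
    at-front : (∃[ m ] i ∷ I ∷ʳ t ≡ Q ++ m) ⊎ (∃[ k ] ∃[ Q₂ ] Q ≡ i ∷ I ++ t ∷ k ∷ Q₂) →
               (∃[ m ] i ∷ I ∷ʳ t ≡ Q ++ m) ⊎ (∃[ m ] t ∷ B ≡ m ++ Q ++ ys) ⊎ Interior t Q
    at-front (inj₁ e) = inj₁ e
    at-front (inj₂ (k , Q₂ , e)) = inj₂ (inj₂ (i , I , k , Q₂ , e))
  infix-split (i ∷ I) t B (x ∷ xs) Q ys eq with refl , eq′ ← ∷-injective eq
    with infix-split I t B xs Q ys eq′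
  ... | inj₁ (m , e) = inj₁ (m , cong (i ∷_) e)
  ... | inj₂ e = inj₂ e

module _ {a c : Level} {V : Set a} {R : V → V → Set c} where

  walk-++ : ∀ {z r₁ t r₂ s} → WalkR R z r₁ t → WalkR R t r₂ s → WalkR R z (r₁ ++ r₂) s
  walk-++ stop ω = ω
  walk-++ (step e ω₁) ω₂ = step e (walk-++ ω₁ ω₂)

  walk-++⁻ : ∀ r₁ {z r₂ s} → WalkR R z (r₁ ++ r₂) s → ∃[ t ] WalkR R z r₁ t × WalkR R t r₂ s
  walk-++⁻ [] ω = _ , stop , ω
  walk-++⁻ (x ∷ r₁) (step e ω) with t , ω₁ , ω₂ ← walk-++⁻ r₁ ω = t , step e ω₁ , ω₂

  walk-map : ∀ {c′} {R′ : V → V → Set c′} → (∀ {s t} → R s t → R′ s t) →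
             ∀ {z r t} → WalkR R z r t → WalkR R′ z r t
  walk-map f stop = stop
  walk-map f (step e ω) = step (f e) (walk-map f ω)

  walk-split : ∀ r₁ {z c r₂ t} → WalkR R z (r₁ ++ c ∷ r₂) t →
               WalkR R z (r₁ ∷ʳ c) c × WalkR R c r₂ t
  walk-split [] (step e ω) = step e stop , ω
  walk-split (x ∷ r₁) (step e ω) = map₁ (step e) (walk-split r₁ ω)

  walk-last : ∀ {z r t} → WalkR R z r t → ∃[ I ] z ∷ r ≡ I ∷ʳ t
  walk-last stop = [] , refl
  walk-last {z} (step e ω) with I , eq ← walk-last ω = z ∷ I , cong (z ∷_) eq

  last∈tail : ∀ {z k r t} → WalkR R z (k ∷ r) t → t ∈ k ∷ r
  last∈tail (step _ ω) = last∈ ω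
    where
    last∈ : ∀ {z r t} → WalkR R z r t → t ∈ z ∷ r
    last∈ stop = here refl
    last∈ (step _ ω) = there (last∈ ω)

  walk-from : ∀ {z r t s} → WalkR R z r t → s ∈ r →
              ∃[ r′ ] WalkR R s r′ t × length r′ < length r
  walk-from (step _ ω) (here refl) = _ , ω , n<1+n _
  walk-from (step _ ω) (there s∈r) with r′ , ω′ , lt ← walk-from ω s∈r = r′ , ω′ , m<n⇒m<1+n lt

  shortcut : ∀ {z r t} → WalkR R z r t → HasRepeat (z ∷ r) →
             ∃[ r′ ] WalkR R z r′ t × length r′ < length r
  shortcut ω ([] , s , J , refl , s∈J) = walk-from ω s∈J
  shortcut stop (_ ∷ [] , _ , _ , () , _)
  shortcut stop (_ ∷ _ ∷ _ , _ , _ , () , _)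
  shortcut (step e ω) (_ ∷ I , s , J , eq , s∈J)
    with r′ , ω′ , lt ← shortcut ω (I , s , J , ∷-injectiveʳ eq , s∈J) = _ ∷ r′ , step e ω′ , s≤s lt

  walk-upto-infix : ∀ {z r t} → WalkR R z r t →
                    ∀ xs {c k cs ys} → z ∷ r ≡ xs ++ (c ∷ k ∷ cs) ++ ys →
                    ∃[ r′ ] WalkR R z r′ c × length r′ < length r
  walk-upto-infix ω [] refl = [] , stop , s≤s z≤n
  walk-upto-infix stop (_ ∷ []) ()
  walk-upto-infix stop (_ ∷ _ ∷ _) ()
  walk-upto-infix (step e ω) (_ ∷ xs) {cs = cs} {ys} eq
    with r′ , ω′ , lt ← walk-upto-infix ω xs {cs = cs} {ys} (∷-injectiveʳ eq) =
    _ ∷ r′ , step e ω′ , s≤s lt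

  walk-along-infix : ∀ {z r t} → WalkR R z r t →
                     ∀ xs {c k cs ys} → z ∷ r ≡ xs ++ (c ∷ k ∷ cs) ++ ys →
                     ∃[ c′ ] WalkR R c (k ∷ cs) c′ × WalkR R c′ ys t × length ys < length r
  walk-along-infix ω [] {cs = cs} {ys} refl with c′ , ω₁ , ω₂ ← walk-++⁻ (_ ∷ cs) {r₂ = ys} ω =
    c′ , ω₁ , ω₂ , s≤s (length-++-≤ʳ ys {cs})
  walk-along-infix stop (_ ∷ []) ()
  walk-along-infix stop (_ ∷ _ ∷ _) ()
  walk-along-infix (step e ω) (_ ∷ xs) {cs = cs} {ys} eq
    with c′ , ω₁ , ω₂ , lt ← walk-along-infix ω xs {cs = cs} {ys} (∷-injectiveʳ eq) =
    c′ , ω₁ , ω₂ , m<n⇒m<1+n lt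

module _ {a b : Level} (G : Digraph a b) where
  open Digraph G

  data Occurrence (Q : List V) (t : V) (L₁ L₂ : List V) : Set a where
    in-first   : Subwalk G Q L₁ → Occurrence Q t L₁ L₂
    in-second  : Subwalk G Q L₂ → Occurrence Q t L₁ L₂
    through-at : Interior t Q → Occurrence Q t L₁ L₂

  subwalk-join : ∀ {c} {R : V → V → Set c} {z r₁ t} r₂ {Q} → WalkR R z r₁ t →
                 Subwalk G Q (z ∷ r₁ ++ r₂) → Occurrence Q t (z ∷ r₁) (t ∷ r₂)
  subwalk-join r₂ {Q} ω (xs , ys , eq) with I , eqI ← walk-last ω
    with infix-split I _ r₂ xs Q ys (trans (sym (trans (cong (_++ r₂) eqI) (++-assoc I _ r₂))) eq)
  ... | inj₁ (m , e) = in-first (xs , m , trans eqI e)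
  ... | inj₂ (inj₁ (m , e)) = in-second (m , ys , e)
  ... | inj₂ (inj₂ int) = through-at int

  avoid-source : ∀ {s s′ z r t} → IsWalk G z r t → s ∉ z ∷ r → WalkR (removeArc G s s′) z r t
  avoid-source stop s∉ = stop
  avoid-source (step e ω) s∉ =
    step (e , λ (z≡s , _) → s∉ (here (sym z≡s))) (avoid-source ω (λ s∈ → s∉ (there s∈)))

  avoid-target : ∀ {s s′ z r t} → IsWalk G z r t → s′ ∉ r → WalkR (removeArc G s s′) z r t
  avoid-target stop s′∉ = stop
  avoid-target (step e ω) s′∉ =
    step (e , λ (_ , x≡s′) → s′∉ (here (sym x≡s′))) (avoid-target ω (λ s′∈ → s′∉ (there s′∈)))

  lastTwo-end : ∀ {c} {R : V → V → Set c} {x y rs t} → WalkR R x (y ∷ rs) t →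
                t ≡ proj₂ (lastTwo G x y rs)
  lastTwo-end {rs = []} (step _ stop) = refl
  lastTwo-end {rs = _ ∷ _} (step _ ω) = lastTwo-end ω

  lastTwo-arc : ∀ {c} {R : V → V → Set c} {x y rs t} → WalkR R x (y ∷ rs) t →
                R (proj₁ (lastTwo G x y rs)) (proj₂ (lastTwo G x y rs))
  lastTwo-arc {rs = []} (step e stop) = e
  lastTwo-arc {rs = _ ∷ _} (step _ ω) = lastTwo-arc ω

  cut-path-repeat-free : ∀ {x y Q} → HasWalk G x y → AllWalksThrough G x y Q → ¬ HasRepeat Q
  cut-path-repeat-free {x} {y} (w , ω) cut repeat = descend ω (<-wellFounded (length w))
    where
    descend : ∀ {w} → IsWalk G x w y → Acc _<_ (length w) → ⊥
    descend ω (acc smaller) with xs , ys , eq ← cut _ ω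
      with w′ , ω′ , lt ← shortcut ω (subst HasRepeat (sym eq) (repeat-infix xs ys repeat)) =
      descend ω′ (smaller lt)

module CutPath {ℓᵥ ℓₑ : Level} (G : Digraph ℓᵥ ℓₑ) (p₁ p₂ : Digraph.V G) (rest : List (Digraph.V G))
               (ωP : IsWalk G p₁ (p₂ ∷ rest) (proj₂ (lastTwo G p₁ p₂ rest)))
               (P-repeat-free : ¬ HasRepeat (p₁ ∷ p₂ ∷ rest)) where
  open Digraph G

  P : List V
  P = p₁ ∷ p₂ ∷ rest

  q pₗ : V
  q = proj₁ (lastTwo G p₁ p₂ rest)
  pₗ = proj₂ (lastTwo G p₁ p₂ rest)

  p₁∉tail : p₁ ∉ p₂ ∷ rest
  p₁∉tail p₁∈ = P-repeat-free ([] , p₁ , p₂ ∷ rest , refl , p₁∈)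

  interior-walks : ∀ {c} → Interior c P →
                   ∃[ Q₁ ] ∃[ k ] ∃[ Q₂ ] p₂ ∷ rest ≡ Q₁ ++ c ∷ k ∷ Q₂
                                          × IsWalk G p₁ (Q₁ ∷ʳ c) c × IsWalk G c (k ∷ Q₂) pₗ
  interior-walks (_ , Q₁ , k , Q₂ , eq) =
    Q₁ , k , Q₂ , ∷-injectiveʳ eq , walk-split Q₁ (subst (λ r → IsWalk G p₁ r pₗ) (∷-injectiveʳ eq) ωP)

  p₁-not-interior : ¬ Interior p₁ P
  p₁-not-interior (_ , Q₁ , _ , _ , eq) =
    p₁∉tail (subst (p₁ ∈_) (sym (∷-injectiveʳ eq)) (∈-++⁺ʳ Q₁ (here refl)))

  pₗ-not-interior : ¬ Interior pₗ P
  pₗ-not-interior int with Q₁ , k , Q₂ , eq , _ , after ← interior-walks int =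
    P-repeat-free (repeat-∷ (Q₁ , pₗ , k ∷ Q₂ , eq , last∈tail after))

  interior⇒R⁻ : ∀ {c} → Interior c P → R⁻ G p₁ p₂ rest c
  interior⇒R⁻ int with Q₁ , k , Q₂ , eq , _ , after ← interior-walks int =
    k ∷ Q₂ , avoid-source G after (λ p₁∈ → p₁∉tail (subst (p₁ ∈_) (sym eq) (∈-++⁺ʳ Q₁ p₁∈)))

  interior⇒R⁺ : ∀ {c} → Interior c P → R⁺ G p₁ p₂ rest c
  interior⇒R⁺ {c} int with Q₁ , k , Q₂ , eq , before , after ← interior-walks int =
    Q₁ ∷ʳ c , avoid-target G before λ pₗ∈ →
      P-repeat-free (repeat-∷ (subst HasRepeat (trans (++-assoc Q₁ [ c ] (k ∷ Q₂)) (sym eq))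
                                                (repeat-++ (Q₁ ∷ʳ c) pₗ∈ (last∈tail after))))

  module _ {x y u v w d g} (cut : AllWalksThrough G x y P)
           (δ : WalkR (removeArc G q pₗ) p₁ d u) (u∉R⁻ : ¬ R⁻ G p₁ p₂ rest u)
           (W : IsWalk G u w v)
           (γ : WalkR (removeArc G p₁ p₂) v g pₗ) (v∉R⁺ : ¬ R⁺ G p₁ p₂ rest v) where

    δ-misses-P : ¬ Subwalk G P (p₁ ∷ d)
    δ-misses-P (xs , _ , eq) with _ , along , _ ← walk-along-infix δ xs {cs = rest} eq =
      proj₂ (lastTwo-arc G along) (refl , refl)

    γ-misses-P : ¬ Subwalk G P (v ∷ g)
    γ-misses-P (xs , _ , eq) with _ , step first-arc _ , _ ← walk-along-infix γ xs {cs = rest} eq =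
      proj₂ first-arc (refl , refl)

    through : ∀ {a b} → IsWalk G x a p₁ → IsWalk G pₗ b y → Acc _<_ (length a + length b) →
              Subwalk G P (u ∷ w)
    through {a} {b} α β (acc smaller) =
      at-u (subwalk-join G (w ++ g ++ b) (walk-++ α (walk-map proj₁ δ)) (cut _ whole))
      where
      whole : IsWalk G x ((a ++ d) ++ w ++ g ++ b) y
      whole = walk-++ (walk-++ α (walk-map proj₁ δ)) (walk-++ W (walk-++ (walk-map proj₁ γ) β))

      at-p₁ : Occurrence G P p₁ (x ∷ a) (p₁ ∷ d) → Subwalk G P (u ∷ w)
      at-p₁ (in-first (xs , _ , eq)) with _ , α′ , shorter ← walk-upto-infix α xs {cs = rest} eq =
        through α′ β (smaller (+-monoˡ-< (length b) shorter))
      at-p₁ (in-second occ) = ⊥-elim (δ-misses-P occ)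
      at-p₁ (through-at int) = ⊥-elim (p₁-not-interior int)

      at-pₗ : Occurrence G P pₗ (v ∷ g) (pₗ ∷ b) → Subwalk G P (u ∷ w)
      at-pₗ (in-first occ) = ⊥-elim (γ-misses-P occ)
      at-pₗ (in-second (xs , _ , eq))
        with _ , along , β′ , shorter ← walk-along-infix β xs {cs = rest} eq =
        through α (subst (λ s → IsWalk G s _ y) (lastTwo-end G along) β′)
                (smaller (+-monoʳ-< (length a) shorter))
      at-pₗ (through-at int) = ⊥-elim (pₗ-not-interior int)

      at-v : Occurrence G P v (u ∷ w) (v ∷ g ++ b) → Subwalk G P (u ∷ w)
      at-v (in-first occ) = occ
      at-v (in-second occ) = at-pₗ (subwalk-join G b (walk-map proj₁ γ) occ)
      at-v (through-at int) = ⊥-elim (v∉R⁺ (interior⇒R⁺ int))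

      at-u : Occurrence G P u (x ∷ a ++ d) (u ∷ w ++ g ++ b) → Subwalk G P (u ∷ w)
      at-u (in-first occ) = at-p₁ (subwalk-join G d α occ)
      at-u (in-second occ) = at-v (subwalk-join G (g ++ b) W occ)
      at-u (through-at int) = ⊥-elim (u∉R⁻ (interior⇒R⁻ int))

lemma14 : ∀ {a b : Level} (G : Digraph a b) → StronglyConnected G →
          (p₁ p₂ : Digraph.V G) (rest : List (Digraph.V G)) →
          IsCutPath G (p₁ ∷ p₂ ∷ rest) →
          (u v : Digraph.V G) → S⁺ G p₁ p₂ rest u → S⁻ G p₁ p₂ rest v →
          AllWalksThrough G u v (p₁ ∷ p₂ ∷ rest)
lemma14 G sc p₁ p₂ rest ((_ , _ , _ , refl , ωP) , x , y , cut)
        u v ((_ , δ) , u∉R⁻) ((_ , γ) , v∉R⁺) w W =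
  through cut δ u∉R⁻ W γ v∉R⁺ (proj₂ (sc x p₁)) (proj₂ (sc pₗ y)) (<-wellFounded _)
  where
  open CutPath G p₁ p₂ rest (subst (IsWalk G p₁ (p₂ ∷ rest)) (lastTwo-end G ωP) ωP)
                            (cut-path-repeat-free G (sc x y) cut)
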